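{- If a function $f:\mathbb{N}\to\mathbb{N}$ is computable by a family $\mathcal{C}=(C_n)_{n\ge0}$ of polynomial-size and constant-depth circuits including majority gates (in the normal form of the context; $f(x)$ is the output of $C_{\ell(x)}$ on input $x$), then $f\in\mathbb{TCDL}_{\mathcal{C}}$.
   Context: $\ell(x)=\lceil\log_2(x+1)\rceil$ is the binary length of $x$ ($\ell(0)=0$); $\mathrm{sg}(x)=1$ if $x>0$, else $0$; $x\div2=\lfloor x/2\rfloor$. The length-ODE $\frac{\partial f(x,\vec y)}{\partial \ell}=E(x,\vec y)$ means $f(x+1,\vec y)=f(x,\vec y)+(\ell(x+1)-\ell(x))\cdot E(x,\vec y)$. Schema $\ell$-ODE$_2^*$: given $g$, $h$ taking values in $\{0,1\}$, and arbitrary $k$, $f$ solves $f(0,\vec y)=g(\vec y)$, $\frac{\partial f}{\partial\ell}=(2^{\ell(k(\vec y))}-1)f(x,\vec y)+h(x,\vec y)$. Schema $\ell$-ODE$_3$: $f(0,\vec y)=g(\vec y)$, $\frac{\partial f}{\partial\ell}=-(f(x,\vec y)-(f(x,\vec y)\div 2))$. Standing assumption on the family: $C_n$ has size $n^k$ (fixed $k$) and constant depth $d$, unbounded fan-in, edges only between consecutive levels, and strictly alternates between gate types: input gates and their negations are at level 0, $\vee$ gates at levels $3e+1$, $\wedge$ gates at levels $3e+2$, majority gates ($\textsc{Maj}$, output 1 iff more than half of the inputs are 1) at levels $3e$ ($e\ge1$); input gates numbered $0,\dots,n-1$, negated inputs $n,\dots,2n-1$, the $m$ output gates $n^k-m,\dots,n^k-1$;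 the output is the binary number formed by the output gates. No uniformity is assumed. $\mathbf{circ}_{\mathcal{C}}=\{C,L_0^{in},L_0^{\neg},L_1,\dots,L_d,m\}$ consists of (characteristic functions of) predicates and a function describing the family: $m(\ell(x))$ is the number of output gates of $C_{\ell(x)}$; $L_0^{in}(a,x)$, $L_0^{\neg}(a,x)$ describe input and negated-input gates of $C_{\ell(x)}$ on input $x$; $L_e(a,x)$ holds iff the $a$-th gate of $C_{\ell(x)}$ is at level $e$; $(x,a,b)\in C$ iff in $C_{\ell(x)}$ gate $a$ is a predecessor of gate $b$ at the next level ($a,b\le\ell(x)^k$). $\mathbb{TCDL}_{\mathcal{C}}=[\mathbf{0},\mathbf{1},\mathbf{circ}_{\mathcal{C}},\div2,\mathrm{sg},\ell,+,-,\pi^p_i;\ \circ,\ \ell\text{ -ODE}_2^*,\ \ell\text{ -ODE}_3]$, the smallest class containing these basic functions (constants, projections) and closed under composition and the two schemas. -}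

module Defs where

open import Data.Nat using (ℕ; zero; suc; _+_; _*_; _∸_; _^_; _≤_; _<_; _⊔_; _/_; _%_; _≡ᵇ_; _<ᵇ_)
open import Data.Nat.Logarithm using (⌈log₂_⌉)
open import Data.Bool using (Bool; true; false; not; _∧_; _∨_; if_then_else_)
open import Data.List using (List; []; _∷_; map; filterᵇ; length; upTo)
open import Data.Bool.ListAction using (and; or)
open import Data.Nat.ListAction using (sum)
open import Data.Fin using (Fin)
open import Data.Product using (Σ; _×_; _,_)
open import Relation.Binary.PropositionalEquality using (_≡_)
import Data.Vec.Functional as VF

ℓ : ℕ → ℕ
ℓ x = ⌈log₂ (suc x) ⌉

sg : ℕ → ℕ
sg zero    = 0
sg (suc _) = 1

half : ℕ → ℕ
half x = x / 2

-- i-th bit of x (bit 0 = least significant)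
bit : ℕ → ℕ → Bool
bit zero    x = (x % 2) ≡ᵇ 1
bit (suc i) x = bit i (x / 2)

toℕ𝔹 : Bool → ℕ
toℕ𝔹 true  = 1
toℕ𝔹 false = 0

-- C_n has gates numbered below  nG n = (2n) ⊔ n^k  (the n^k gates of the
-- paper; the ⊔ 2n only matters for the degenerate n = 1 / tiny sizes
-- where n^k < 2n).
-- lev n a  : the level of gate a in C_n
-- wire n a b : gate a is a predecessor of gate b in C_n
-- m n : number of output gates of C_n

record NFFamily : Set where
  field
    k d  : ℕ
    lev  : ℕ → ℕ → ℕ
    wire : ℕ → ℕ → ℕ → Bool
    m    : ℕ → ℕ
  nG : ℕ → ℕ
  nG n = (2 * n) ⊔ (n ^ k)
  field
    -- gates 0..2n-1 (inputs and negated inputs) are at level 0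
    inputLevel : ∀ n a → a < 2 * n → lev n a ≡ 0
    innerLevel : ∀ n a → 2 * n ≤ a → a < n ^ k → 1 ≤ lev n a × lev n a ≤ d
    wireOK     : ∀ n a b → wire n a b ≡ true →
                 a < nG n × b < nG n × lev n b ≡ suc (lev n a)
    -- the output gates are n^k - m n, …, n^k - 1
    outputsOK  : ∀ n → m n ≤ n ^ k

module Eval (F : NFFamily) where
  open NFFamily F

  -- value of gate a of C_n on input x, computed as a gate of level e;
  -- level 3e+1: ∨, level 3e+2: ∧, level 3e (e ≥ 1): Maj
  combine : ℕ → List Bool → Bool
  combine e bs with e % 3
  ... | 1 = or bs
  ... | 2 = and bs
  ... | _ = length bs <ᵇ 2 * length (filterᵇ (λ b → b) bs)

  valAt : ℕ → ℕ → ℕ → ℕ → Bool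
  valAt n x zero a =
    if a <ᵇ n then bit a x
    else (if a <ᵇ 2 * n then not (bit (a ∸ n) x) else false)
  valAt n x (suc e) a =
    combine (suc e) (map (valAt n x e) (filterᵇ (λ b → wire n b a) (upTo (nG n))))

  gateVal : ℕ → ℕ → ℕ → Bool
  gateVal n x a = valAt n x (lev n a) a

  output : ℕ → ℕ
  output x = sum (map (λ i → 2 ^ i * toℕ𝔹 (gateVal n x ((n ^ k ∸ m n) + i))) (upTo (m n)))
    where n = ℓ x

  Computes : (ℕ → ℕ) → Set
  Computes f = ∀ x → f x ≡ output x

  χ : Bool → ℕ
  χ = toℕ𝔹

  circC : ℕ → ℕ → ℕ → ℕ
  circC x a b = χ (wire (ℓ x) a b)

  L0in : ℕ → ℕ → ℕ
  L0in a x = χ ((a <ᵇ ℓ x) ∧ bit a x)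

  L0neg : ℕ → ℕ → ℕ
  L0neg a x = χ (not (a <ᵇ ℓ x) ∧ (a <ᵇ 2 * ℓ x) ∧ not (bit (a ∸ ℓ x) x))

  Lev : ℕ → ℕ → ℕ → ℕ
  Lev e a x = χ ((a <ᵇ nG (ℓ x)) ∧ (lev (ℓ x) a ≡ᵇ e))

-- The function algebra TCDL_C.  Functions of arity p are maps
-- (Fin p → ℕ) → ℕ; argument 0 is the ODE variable x.

Fun : ℕ → Set
Fun p = (Fin p → ℕ) → ℕ

ode2 : ∀ {p} → Fun p → Fun (suc p) → Fun p → ℕ → (Fin p → ℕ) → ℕ
ode2 g h k zero    y = g y
ode2 g h k (suc x) y =
  ode2 g h k x y + (ℓ (suc x) ∸ ℓ x) * ((2 ^ ℓ (k y) ∸ 1) * ode2 g h k x y + h (x VF.∷ y))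

ode3 : ∀ {p} → Fun p → ℕ → (Fin p → ℕ) → ℕ
ode3 g zero    y = g y
ode3 g (suc x) y = ode3 g x y ∸ (ℓ (suc x) ∸ ℓ x) * (ode3 g x y ∸ half (ode3 g x y))

asFun : ∀ {p} → (ℕ → (Fin p → ℕ) → ℕ) → Fun (suc p)
asFun s v = s (VF.head v) (VF.tail v)

module Algebra (F : NFFamily) where
  open NFFamily F
  open Eval F

  data TCDL : (p : ℕ) → Fun p → Set where
    zeroF : TCDL 0 (λ _ → 0)
    oneF  : TCDL 0 (λ _ → 1)
    circCF : TCDL 3 (λ v → circC (v Fin.zero) (v (Fin.suc Fin.zero)) (v (Fin.suc (Fin.suc Fin.zero))))
    L0inF  : TCDL 2 (λ v → L0in (v Fin.zero) (v (Fin.suc Fin.zero)))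
    L0negF : TCDL 2 (λ v → L0neg (v Fin.zero) (v (Fin.suc Fin.zero)))
    LevF   : (e : ℕ) → 1 ≤ e → e ≤ d → TCDL 2 (λ v → Lev e (v Fin.zero) (v (Fin.suc Fin.zero)))
    mF     : TCDL 1 (λ v → m (v Fin.zero))
    halfF : TCDL 1 (λ v → half (v Fin.zero))
    sgF   : TCDL 1 (λ v → sg (v Fin.zero))
    ℓF    : TCDL 1 (λ v → ℓ (v Fin.zero))
    plusF : TCDL 2 (λ v → v Fin.zero + v (Fin.suc Fin.zero))
    monusF : TCDL 2 (λ v → v Fin.zero ∸ v (Fin.suc Fin.zero))
    proj  : (p : ℕ) (i : Fin p) → TCDL p (λ v → v i)
    comp  : ∀ {p q} {h : Fun q} {gs : Fin q → Fun p} →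
            TCDL q h → ((i : Fin q) → TCDL p (gs i)) →
            TCDL p (λ v → h (λ i → gs i v))
    lode2 : ∀ {p} {g : Fun p} {h : Fun (suc p)} {k′ : Fun p} →
            TCDL p g → TCDL (suc p) h → TCDL p k′ →
            (∀ y → g y ≤ 1) → (∀ v → h v ≤ 1) →
            TCDL (suc p) (asFun (ode2 g h k′))
    lode3 : ∀ {p} {g : Fun p} → TCDL p g → TCDL (suc p) (asFun (ode3 g))

  _∈TCDL : (ℕ → ℕ) → Set
  f ∈TCDL = Σ (Fun 1) λ F′ → TCDL 1 F′ × (∀ x → F′ (λ _ → x) ≡ f x)

{-# OPTIONS --safe #-}
-- Gate values are computed level by level.  On {0,1} the connectives are arithmetic
-- (∧ is ⊓, ¬ is 1 ∸ _), and a length-ODE with k = 0 sums a 0/1 function over j < ℓ(X).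
-- Taking X longer than the number of gates (such lengths come from ℓ-ODE_2^* with g = 1,
-- h = 0, whose solution is 2^(ℓ(x)·ℓ(y))), the number of true predecessors of a gate is
-- definable, whence ∨ = sg(count), ∧ = 1 ∸ sg(count of false), Maj = sg(2·count ∸ fan-in).
-- The predicates L_e pick out each gate's value at its own level, and a length-ODE with
-- k = 1, which doubles and adds, assembles the output bits into a number (Horner's rule).
module Submission where

open import Defs
open import Data.Nat using (ℕ; zero; suc; _+_; _*_; _∸_; _^_; _%_; _≤_; _<_; _⊓_; _≡ᵇ_; _<ᵇ_; z≤n; s≤s)
open import Data.Nat.Properties
open import Data.Nat.Logarithm using (⌈log₂_⌉; ⌈log₂⌉-mono-≤; ⌈log₂2*n⌉≡1+⌈log₂n⌉; ⌈log₂2^n⌉≡n)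
open import Data.Nat.DivMod using (m%n<n)
open import Data.Nat.ListAction using (sum)
open import Data.Nat.ListAction.Properties using (sum-++)
open import Data.Nat.Tactic.RingSolver using (solve-∀)
open import Data.Bool using (Bool; true; false; not; _∧_)
open import Data.Bool.Properties using (∧-zeroʳ)
open import Data.Bool.ListAction using (and; or)
open import Data.List using (List; []; _∷_; _++_; [_]; _∷ʳ_; map; filterᵇ; length; upTo)
open import Data.List.Properties using (map-++; map-∘; applyUpTo-∷ʳ; length-map)
open import Data.Fin using (Fin; #_) renaming (zero to fz; suc to fs)
open import Data.Product using (_,_; proj₁; proj₂)
open import Data.Sum using (_⊎_; inj₁; inj₂)
open import Data.Empty using (⊥-elim)
open import Function using (id; _∘_)
open import Relation.Nullary using (yes; no)
open import Relation.Nullary.Decidable using (dec-true; dec-false)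
open import Relation.Binary.PropositionalEquality hiding ([_])
import Data.Vec.Functional as VF

ℓ-mono : ∀ {x y} → x ≤ y → ℓ x ≤ ℓ y
ℓ-mono x≤y = ⌈log₂⌉-mono-≤ (s≤s x≤y)

ℓ-suc≤ : ∀ x → ℓ (suc x) ≤ suc (ℓ x)
ℓ-suc≤ x =
  ≤-trans (⌈log₂⌉-mono-≤ 2+x≤2*[1+x]) (≤-reflexive (⌈log₂2*n⌉≡1+⌈log₂n⌉ (suc x)))
  where
  2+x≤2*[1+x] : suc (suc x) ≤ 2 * suc x
  2+x≤2*[1+x] = subst (_≤ 2 * suc x) (+-comm (suc x) 1) (+-monoʳ-≤ (suc x) (s≤s z≤n))

ℓ-suc : ∀ x → ℓ (suc x) ≡ ℓ x ⊎ ℓ (suc x) ≡ suc (ℓ x)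
ℓ-suc x with m≤n⇒m<n∨m≡n (ℓ-mono (n≤1+n x))
... | inj₁ ℓx<ℓ[1+x] = inj₂ (≤-antisym (ℓ-suc≤ x) ℓx<ℓ[1+x])
... | inj₂ ℓx≡ℓ[1+x] = inj₁ (sym ℓx≡ℓ[1+x])

ℓ[2^n∸1]≡n : ∀ n → ℓ (2 ^ n ∸ 1) ≡ n
ℓ[2^n∸1]≡n n = trans (cong ⌈log₂_⌉ (m+[n∸m]≡n (m^n>0 2 n))) (⌈log₂2^n⌉≡n n)

n≤ℓ[2^n] : ∀ n → n ≤ ℓ (2 ^ n)
n≤ℓ[2^n] n = subst (_≤ ℓ (2 ^ n)) (⌈log₂2^n⌉≡n n) (⌈log₂⌉-mono-≤ (n≤1+n (2 ^ n)))

∑< : ℕ → (ℕ → ℕ) → ℕ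
∑< zero    f = 0
∑< (suc n) f = ∑< n f + f n

infix 5 ∑<
syntax ∑< n (λ i → e) = ∑[ i < n ] e

∑-cong : ∀ n {f g : ℕ → ℕ} → (∀ i → i < n → f i ≡ g i) → ∑< n f ≡ ∑< n g
∑-cong zero    f≡g = refl
∑-cong (suc n) f≡g = cong₂ _+_ (∑-cong n (λ i i<n → f≡g i (m<n⇒m<1+n i<n))) (f≡g n ≤-refl)

∑-zero : ∀ n {f : ℕ → ℕ} → (∀ i → i < n → f i ≡ 0) → ∑< n f ≡ 0
∑-zero zero    f≡0 = refl
∑-zero (suc n) f≡0 = cong₂ _+_ (∑-zero n (λ i i<n → f≡0 i (m<n⇒m<1+n i<n))) (f≡0 n ≤-refl)

∑-single : ∀ n {f : ℕ → ℕ} j → j < n → (∀ i → i ≢ j → f i ≡ 0) → ∑< n f ≡ f j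
∑-single (suc n) {f} j j<1+n f≡0 with m≤n⇒m<n∨m≡n (≤-pred j<1+n)
... | inj₁ j<n = begin
  ∑< n f + f n ≡⟨ cong₂ _+_ (∑-single n j j<n f≡0) (f≡0 n (>⇒≢ j<n)) ⟩
  f j + 0      ≡⟨ +-identityʳ (f j) ⟩
  f j          ∎
  where open ≡-Reasoning
... | inj₂ refl = cong (_+ f j) (∑-zero j (λ i i<j → f≡0 i (<⇒≢ i<j)))

∑-extend : ∀ {m n} {f : ℕ → ℕ} → m ≤ n → (∀ i → m ≤ i → f i ≡ 0) → ∑< n f ≡ ∑< m f
∑-extend {n = zero}  z≤n f≡0 = refl
∑-extend {n = suc n} m≤1+n f≡0 with m≤n⇒m<n∨m≡n m≤1+n
... | inj₁ m<1+n = trans (cong₂ _+_ (∑-extend (≤-pred m<1+n) f≡0) (f≡0 n (≤-pred m<1+n)))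
                         (+-identityʳ _)
... | inj₂ refl  = refl

sum-map-upTo : ∀ (f : ℕ → ℕ) n → sum (map f (upTo n)) ≡ ∑[ i < n ] f i
sum-map-upTo f zero    = refl
sum-map-upTo f (suc n) = begin
  sum (map f (upTo (suc n)))          ≡⟨ cong (sum ∘ map f) (sym (applyUpTo-∷ʳ id n)) ⟩
  sum (map f (upTo n ∷ʳ n))           ≡⟨ cong sum (map-++ f (upTo n) [ n ]) ⟩
  sum (map f (upTo n) ++ [ f n ])     ≡⟨ sum-++ (map f (upTo n)) [ f n ] ⟩
  sum (map f (upTo n)) + (f n + 0)    ≡⟨ cong₂ _+_ (sum-map-upTo f n) (+-identityʳ (f n)) ⟩
  (∑[ i < n ] f i) + f n              ∎
  where open ≡-Reasoning

horner : (ℕ → ℕ) → ℕ → ℕ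
horner c zero    = 0
horner c (suc j) = 2 * horner c j + c j

-- Horner's invariant after j of the n digits (most significant first), r = n − j left.
horner-∑ : ∀ (c : ℕ → ℕ) n j r → j + r ≡ n →
  horner (λ t → c (n ∸ suc t)) j * 2 ^ r + (∑[ i < r ] 2 ^ i * c i) ≡ ∑[ i < n ] 2 ^ i * c i
horner-∑ c n zero    r refl = refl
horner-∑ c n (suc j) r 1+j+r≡n = begin
  (2 * H + c (n ∸ suc j)) * 2 ^ r + (∑[ i < r ] 2 ^ i * c i)
    ≡⟨ cong (λ i → (2 * H + c i) * 2 ^ r + (∑[ i < r ] 2 ^ i * c i)) n∸[1+j]≡r ⟩
  (2 * H + c r) * 2 ^ r + (∑[ i < r ] 2 ^ i * c i)
    ≡⟨ regroup H (c r) (2 ^ r) (∑[ i < r ] 2 ^ i * c i) ⟩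
  H * 2 ^ suc r + (∑[ i < suc r ] 2 ^ i * c i)
    ≡⟨ horner-∑ c n j (suc r) (trans (+-suc j r) 1+j+r≡n) ⟩
  ∑[ i < n ] 2 ^ i * c i ∎
  where
  open ≡-Reasoning
  H = horner (λ t → c (n ∸ suc t)) j
  n∸[1+j]≡r : n ∸ suc j ≡ r
  n∸[1+j]≡r = trans (cong (_∸ suc j) (sym 1+j+r≡n)) (m+n∸m≡n (suc j) r)
  regroup : ∀ h d p s → (2 * h + d) * p + s ≡ h * (2 * p) + (s + p * d)
  regroup = solve-∀

horner-binary : ∀ (c : ℕ → ℕ) n → horner (λ t → c (n ∸ suc t)) n ≡ ∑[ i < n ] 2 ^ i * c i
horner-binary c n = begin
  H                      ≡⟨ *-identityʳ H ⟨
  H * 2 ^ 0              ≡⟨ +-identityʳ _ ⟨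
  H * 2 ^ 0 + 0          ≡⟨ horner-∑ c n n 0 (+-identityʳ n) ⟩
  ∑[ i < n ] 2 ^ i * c i ∎
  where
  open ≡-Reasoning
  H = horner (λ t → c (n ∸ suc t)) n

χ≤1 : ∀ b → toℕ𝔹 b ≤ 1
χ≤1 true  = s≤s z≤n
χ≤1 false = z≤n

sg≤1 : ∀ n → sg n ≤ 1
sg≤1 zero    = z≤n
sg≤1 (suc n) = s≤s z≤n

χ-∧ : ∀ a b → toℕ𝔹 (a ∧ b) ≡ toℕ𝔹 a ⊓ toℕ𝔹 b
χ-∧ true  true  = refl
χ-∧ true  false = refl
χ-∧ false _     = refl

χ-not : ∀ b → toℕ𝔹 (not b) ≡ 1 ∸ toℕ𝔹 b
χ-not true  = refl
χ-not false = refl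

χ-<ᵇ : ∀ m n → toℕ𝔹 (m <ᵇ n) ≡ sg (n ∸ m)
χ-<ᵇ zero    zero    = refl
χ-<ᵇ zero    (suc n) = refl
χ-<ᵇ (suc m) zero    = refl
χ-<ᵇ (suc m) (suc n) = χ-<ᵇ m n

<⇒<ᵇ≡true : ∀ {m n} → m < n → (m <ᵇ n) ≡ true
<⇒<ᵇ≡true m<n = dec-true (_ <? _) m<n

≥⇒<ᵇ≡false : ∀ {m n} → n ≤ m → (m <ᵇ n) ≡ false
≥⇒<ᵇ≡false n≤m = dec-false (_ <? _) (≤⇒≯ n≤m)

≡⇒≡ᵇ≡true : ∀ {m n} → m ≡ n → (m ≡ᵇ n) ≡ true
≡⇒≡ᵇ≡true m≡n = dec-true (_ ≟ _) m≡n

≢⇒≡ᵇ≡false : ∀ {m n} → m ≢ n → (m ≡ᵇ n) ≡ false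
≢⇒≡ᵇ≡false m≢n = dec-false (_ ≟ _) m≢n

sg-pos : ∀ {n} → 0 < n → sg n ≡ 1
sg-pos {suc n} _ = refl

m∸[m∸n]≡m⊓n : ∀ m n → m ∸ (m ∸ n) ≡ m ⊓ n
m∸[m∸n]≡m⊓n m n with ≤-total n m
... | inj₁ n≤m = trans (m∸[m∸n]≡n n≤m) (sym (m≥n⇒m⊓n≡n n≤m))
... | inj₂ m≤n = trans (cong (m ∸_) (m≤n⇒m∸n≡0 m≤n)) (sym (m≤n⇒m⊓n≡m m≤n))

χ-or : ∀ bs → toℕ𝔹 (or bs) ≡ sg (sum (map toℕ𝔹 bs))
χ-or []           = refl
χ-or (true  ∷ bs) = refl
χ-or (false ∷ bs) = χ-or bs

χ-and : ∀ bs → toℕ𝔹 (and bs) ≡ 1 ∸ sg (sum (map (toℕ𝔹 ∘ not) bs))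
χ-and []           = refl
χ-and (true  ∷ bs) = χ-and bs
χ-and (false ∷ bs) = refl

length-filter-true : ∀ bs → length (filterᵇ id bs) ≡ sum (map toℕ𝔹 bs)
length-filter-true []           = refl
length-filter-true (true  ∷ bs) = cong suc (length-filter-true bs)
length-filter-true (false ∷ bs) = length-filter-true bs

length≡sum-map-1 : ∀ {A : Set} (xs : List A) → length xs ≡ sum (map (λ _ → 1) xs)
length≡sum-map-1 []       = refl
length≡sum-map-1 (x ∷ xs) = cong suc (length≡sum-map-1 xs)

sum-map-filter : ∀ (p W : ℕ → Bool) xs →
  sum (map (toℕ𝔹 ∘ W) (filterᵇ p xs)) ≡ sum (map (λ x → toℕ𝔹 (p x ∧ W x)) xs)
sum-map-filter p W []       = refl
sum-map-filter p W (x ∷ xs) with p x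
... | true  = cong (toℕ𝔹 (W x) +_) (sum-map-filter p W xs)
... | false = sum-map-filter p W xs

ode2-by-length : ∀ {p} {g : Fun p} {h : Fun (suc p)} {k : Fun p} {y : Fin p → ℕ} (G H : ℕ → ℕ) →
  G 0 ≡ g y →
  (∀ j → G (suc j) ≡ G j + ((2 ^ ℓ (k y) ∸ 1) * G j + H j)) →
  (∀ x → h (x VF.∷ y) ≡ H (ℓ x)) →
  ∀ x → ode2 g h k x y ≡ G (ℓ x)
ode2-by-length G H G0 Gsuc h≡H zero = sym G0
ode2-by-length {g = g} {h} {k} {y} G H G0 Gsuc h≡H (suc x) with ℓ-suc x
... | inj₁ ℓ-same rewrite ℓ-same | n∸n≡0 (ℓ x) =
  trans (+-identityʳ _) (ode2-by-length G H G0 Gsuc h≡H x)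
... | inj₂ ℓ-step rewrite ℓ-step | m+n∸n≡m 1 (ℓ x) = begin
  f + ((c * f + h (x VF.∷ y)) + 0)   ≡⟨ cong (f +_) (+-identityʳ _) ⟩
  f + (c * f + h (x VF.∷ y))         ≡⟨ cong₂ (λ a b → a + (c * a + b))
                                              (ode2-by-length G H G0 Gsuc h≡H x) (h≡H x) ⟩
  G (ℓ x) + (c * G (ℓ x) + H (ℓ x))  ≡⟨ Gsuc (ℓ x) ⟨
  G (suc (ℓ x))                      ∎
  where
  open ≡-Reasoning
  f = ode2 g h k x y
  c = 2 ^ ℓ (k y) ∸ 1

infix 4 _≐_
_≐_ : ∀ {p} → Fun p → Fun p → Set
f ≐ g = ∀ {v w} → v ≗ w → f v ≡ g w

∷-cong : ∀ {p} x {y y′ : Fin p → ℕ} → y ≗ y′ → (x VF.∷ y) ≗ (x VF.∷ y′)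
∷-cong x y≗y′ fz     = refl
∷-cong x y≗y′ (fs i) = y≗y′ i

asFun-ext : ∀ {p} {s s′ : ℕ → (Fin p → ℕ) → ℕ} →
  (∀ x {y y′} → y ≗ y′ → s x y ≡ s′ x y′) → asFun s ≐ asFun s′
asFun-ext {s = s} s≐s′ {v} {w} v≗w =
  trans (cong (λ x → s x (VF.tail v)) (v≗w (# 0))) (s≐s′ (VF.head w) (v≗w ∘ fs))

ode2-ext : ∀ {p} {g g′ : Fun p} {h h′ : Fun (suc p)} {k k′ : Fun p} →
  g ≐ g′ → h ≐ h′ → k ≐ k′ → asFun (ode2 g h k) ≐ asFun (ode2 g′ h′ k′)
ode2-ext {g = g} {g′} {h} {h′} {k} {k′} g≐g′ h≐h′ k≐k′ = asFun-ext solution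
  where
  solution : ∀ x {y y′} → y ≗ y′ → ode2 g h k x y ≡ ode2 g′ h′ k′ x y′
  solution zero    y≗y′ = g≐g′ y≗y′
  solution (suc x) y≗y′ rewrite solution x y≗y′ | k≐k′ y≗y′ | h≐h′ (∷-cong x y≗y′) = refl

ode3-ext : ∀ {p} {g g′ : Fun p} → g ≐ g′ → asFun (ode3 g) ≐ asFun (ode3 g′)
ode3-ext {g = g} {g′} g≐g′ = asFun-ext solution
  where
  solution : ∀ x {y y′} → y ≗ y′ → ode3 g x y ≡ ode3 g′ x y′
  solution zero    y≗y′ = g≐g′ y≗y′
  solution (suc x) y≗y′ rewrite solution x y≗y′ = refl

module Definability (F : NFFamily) where
  open NFFamily F using (m)
  open Eval F using (circC; L0in; L0neg; Lev)
  open Algebra F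

  private variable
    p q : ℕ
    f g h k : Fun p

  TCDL-ext : TCDL p f → f ≐ f
  TCDL-ext zeroF          v≗w = refl
  TCDL-ext oneF           v≗w = refl
  TCDL-ext circCF         v≗w rewrite v≗w (# 0) | v≗w (# 1) | v≗w (# 2) = refl
  TCDL-ext L0inF          v≗w = cong₂ L0in (v≗w (# 0)) (v≗w (# 1))
  TCDL-ext L0negF         v≗w = cong₂ L0neg (v≗w (# 0)) (v≗w (# 1))
  TCDL-ext (LevF e _ _)   v≗w = cong₂ (Lev e) (v≗w (# 0)) (v≗w (# 1))
  TCDL-ext mF             v≗w = cong m (v≗w (# 0))
  TCDL-ext halfF          v≗w = cong half (v≗w (# 0))
  TCDL-ext sgF            v≗w = cong sg (v≗w (# 0))
  TCDL-ext ℓF             v≗w = cong ℓ (v≗w (# 0))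
  TCDL-ext plusF          v≗w = cong₂ _+_ (v≗w (# 0)) (v≗w (# 1))
  TCDL-ext monusF         v≗w = cong₂ _∸_ (v≗w (# 0)) (v≗w (# 1))
  TCDL-ext (proj _ i)     v≗w = v≗w i
  TCDL-ext (comp th tgs)  v≗w = TCDL-ext th (λ i → TCDL-ext (tgs i) v≗w)
  TCDL-ext (lode2 tg th tk _ _) = ode2-ext (TCDL-ext tg) (TCDL-ext th) (TCDL-ext tk)
  TCDL-ext (lode3 tg)     = ode3-ext (TCDL-ext tg)

  -- TCDL p f is indexed by f itself, so it is not closed under pointwise equality of f
  -- (no function extensionality); Definable is.
  record Definable (p : ℕ) (f : Fun p) : Set where
    constructor definedBy
    field
      {witness} : Fun p
      inTCDL    : TCDL p witness
      agrees    : witness ≗ f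

    witness≐f : witness ≐ f
    witness≐f v≗w = trans (TCDL-ext inTCDL v≗w) (agrees _)

    witness≤1 : (∀ v → f v ≤ 1) → ∀ v → witness v ≤ 1
    witness≤1 f≤1 v = subst (_≤ 1) (sym (agrees v)) (f≤1 v)

  open Definable

  definable : TCDL p f → Definable p f
  definable t = definedBy t (λ _ → refl)

  definable-cong : ∀ {f′} → Definable p f → f ≗ f′ → Definable p f′
  definable-cong (definedBy t agrees) f≗f′ = definedBy t (λ v → trans (agrees v) (f≗f′ v))

  compᴰ : Definable q h → {us : (Fin p → ℕ) → Fin q → ℕ} →
          (∀ i → Definable p (λ v → us v i)) → Definable p (λ v → h (us v))
  compᴰ (definedBy t h′≗h) dus = definedBy (comp t (inTCDL ∘ dus)) λ v →
    trans (TCDL-ext t (λ i → agrees (dus i) v)) (h′≗h _)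

  varᴰ : (i : Fin p) → Definable p (λ v → v i)
  varᴰ i = definable (proj _ i)

  consᴰ : ∀ {t : Fun (suc q)} {a : Fun p} {ys : (Fin p → ℕ) → Fin q → ℕ} →
          Definable (suc q) t → Definable p a → (∀ i → Definable p (λ v → ys v i)) →
          Definable p (λ v → t (a v VF.∷ ys v))
  consᴰ dt da dys = compᴰ dt λ { fz → da ; (fs i) → dys i }

  0ᴰ : Definable p (λ _ → 0)
  0ᴰ = compᴰ (definable zeroF) {us = λ _ → VF.[]} (λ ())

  1ᴰ : Definable p (λ _ → 1)
  1ᴰ = compᴰ (definable oneF) {us = λ _ → VF.[]} (λ ())

  app₁ : ∀ (φ : ℕ → ℕ) {a : Fun p} →
         Definable 1 (λ v → φ (v (# 0))) → Definable p a → Definable p (λ v → φ (a v))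
  app₁ φ {a} dφ da = compᴰ dφ {us = λ v → a v VF.∷ VF.[]} λ { fz → da }

  app₂ : ∀ (φ : ℕ → ℕ → ℕ) {a b : Fun p} →
         Definable 2 (λ v → φ (v (# 0)) (v (# 1))) → Definable p a → Definable p b →
         Definable p (λ v → φ (a v) (b v))
  app₂ φ {a} {b} dφ da db =
    compᴰ dφ {us = λ v → a v VF.∷ b v VF.∷ VF.[]} λ { fz → da ; (fs fz) → db }

  app₃ : ∀ (φ : ℕ → ℕ → ℕ → ℕ) {a b c : Fun p} →
         Definable 3 (λ v → φ (v (# 0)) (v (# 1)) (v (# 2))) →
         Definable p a → Definable p b → Definable p c → Definable p (λ v → φ (a v) (b v) (c v))
  app₃ φ {a} {b} {c} dφ da db dc =
    compᴰ dφ {us = λ v → a v VF.∷ b v VF.∷ c v VF.∷ VF.[]}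
             λ { fz → da ; (fs fz) → db ; (fs (fs fz)) → dc }

  infixl 6 _+ᴰ_ _∸ᴰ_
  infixl 7 _⊓ᴰ_

  _+ᴰ_ : Definable p f → Definable p g → Definable p (λ v → f v + g v)
  _+ᴰ_ = app₂ _+_ (definable plusF)

  _∸ᴰ_ : Definable p f → Definable p g → Definable p (λ v → f v ∸ g v)
  _∸ᴰ_ = app₂ _∸_ (definable monusF)

  _⊓ᴰ_ : Definable p f → Definable p g → Definable p (λ v → f v ⊓ g v)
  _⊓ᴰ_ {f = f} {g = g} df dg =
    definable-cong (df ∸ᴰ (df ∸ᴰ dg)) (λ v → m∸[m∸n]≡m⊓n (f v) (g v))

  sgᴰ : Definable p f → Definable p (λ v → sg (f v))
  sgᴰ = app₁ sg (definable sgF)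

  ℓᴰ : Definable p f → Definable p (λ v → ℓ (f v))
  ℓᴰ = app₁ ℓ (definable ℓF)

  ∑ᴰ : ∀ n {f : ℕ → Fun p} → (∀ i → i < n → Definable p (f i)) →
       Definable p (λ v → ∑[ i < n ] f i v)
  ∑ᴰ zero    df = 0ᴰ
  ∑ᴰ (suc n) df = ∑ᴰ n (λ i i<n → df i (m<n⇒m<1+n i<n)) +ᴰ df n ≤-refl

  ode2ᴰ : Definable p g → Definable (suc p) h → Definable p k →
          (∀ y → g y ≤ 1) → (∀ v → h v ≤ 1) → Definable (suc p) (asFun (ode2 g h k))
  ode2ᴰ dg dh dk g≤1 h≤1 =
    definedBy (lode2 (inTCDL dg) (inTCDL dh) (inTCDL dk) (witness≤1 dg g≤1) (witness≤1 dh h≤1))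
              (λ v → ode2-ext (witness≐f dg) (witness≐f dh) (witness≐f dk) {v} (λ _ → refl))

  -- With g = 1, h = 0 and k = y each step multiplies by 2^ℓ(y).
  pow2ᴰ : ∀ {a b : Fun p} → Definable p a → Definable p b →
          Definable p (λ v → 2 ^ (ℓ (a v) * ℓ (b v)))
  pow2ᴰ = app₂ (λ s t → 2 ^ (ℓ s * ℓ t)) (definable-cong solutionᴰ λ v →
    ode2-by-length (λ j → 2 ^ (j * ℓ (v (# 1)))) (λ _ → 0) refl
                   (λ j → 2^[1+j]*w j (ℓ (v (# 1)))) (λ _ → refl) (v (# 0)))
    where
    solutionᴰ = ode2ᴰ {p = 1} 1ᴰ 0ᴰ (varᴰ (# 0)) (λ _ → ≤-refl) (λ _ → z≤n)
    2^[1+j]*w : ∀ j w → 2 ^ (suc j * w) ≡ 2 ^ (j * w) + ((2 ^ w ∸ 1) * 2 ^ (j * w) + 0)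
    2^[1+j]*w j w = begin
      2 ^ (w + j * w)                      ≡⟨ ^-distribˡ-+-* 2 w (j * w) ⟩
      2 ^ w * 2 ^ (j * w)                  ≡⟨ cong (_* 2 ^ (j * w)) (m+[n∸m]≡n (m^n>0 2 w)) ⟨
      (1 + (2 ^ w ∸ 1)) * 2 ^ (j * w)      ≡⟨ cong (2 ^ (j * w) +_) (+-identityʳ _) ⟨
      2 ^ (j * w) + ((2 ^ w ∸ 1) * 2 ^ (j * w) + 0) ∎
      where open ≡-Reasoning

  tailᴰ : ∀ {a : Fun p} → Definable p a → Definable (suc p) (λ u → a (VF.tail u))
  tailᴰ da = compᴰ da (varᴰ ∘ fs)

  -- With k = 0 the solution accumulates h, and only at the x where ℓ(x) grows.
  lengthSumᴰ : ∀ {X : Fun p} → Definable (suc p) h → (∀ v → h v ≤ 1) → Definable p X →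
               Definable p (λ y → ∑[ j < ℓ (X y) ] h (j VF.∷ y))
  lengthSumᴰ {h = h} {X} dh h≤1 dX =
    definable-cong (consᴰ (ode2ᴰ 0ᴰ dh′ 0ᴰ (λ _ → z≤n) (λ _ → h≤1 _)) dX varᴰ) λ y →
      ode2-by-length (λ j → ∑[ i < j ] h (i VF.∷ y)) (λ j → h (j VF.∷ y))
                     refl (λ _ → refl) (λ _ → refl) (X y)
    where
    dh′ : Definable (suc _) (λ u → h (ℓ (VF.head u) VF.∷ VF.tail u))
    dh′ = consᴰ dh (ℓᴰ (varᴰ (# 0))) (varᴰ ∘ fs)

  -- With k = 1 each step doubles and adds a digit: Horner's rule, from the top digit down.
  binaryᴰ : ∀ {c : Fun (suc p)} {X : Fun p} →
            Definable (suc p) c → (∀ v → c v ≤ 1) → Definable p X →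
            Definable p (λ y → ∑[ i < ℓ (X y) ] 2 ^ i * c (i VF.∷ y))
  binaryᴰ {c = c} {X} dc c≤1 dX =
    definable-cong (consᴰ (ode2ᴰ 0ᴰ dh 1ᴰ (λ _ → z≤n) (λ _ → c≤1 _)) dX varᴰ) λ y →
      let digit = λ i → c (i VF.∷ y)
          H     = λ t → digit (ℓ (X y) ∸ suc t)
          doubling = λ j → +-assoc (horner H j) (horner H j + 0) (H j)
      in trans (ode2-by-length (horner H) H refl doubling (λ _ → refl) (X y))
               (horner-binary digit (ℓ (X y)))
    where
    dh : Definable (suc _) (λ u → c ((ℓ (X (VF.tail u)) ∸ suc (ℓ (VF.head u))) VF.∷ VF.tail u))
    dh = consᴰ dc (ℓᴰ (tailᴰ dX) ∸ᴰ (1ᴰ +ᴰ ℓᴰ (varᴰ (# 0)))) (varᴰ ∘ fs)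

module Simulation (F : NFFamily) where
  open NFFamily F
  open Eval F
  open Algebra F
  open Definability F

  private variable
    p : ℕ

  ones : ℕ → ℕ → ℕ
  ones zero    x = 1
  ones (suc i) x = 2 ^ (ℓ x * ℓ (ones i x)) ∸ 1

  ℓ-ones : ∀ i x → ℓ (ones i x) ≡ ℓ x ^ i
  ℓ-ones zero    x = refl
  ℓ-ones (suc i) x = trans (ℓ[2^n∸1]≡n _) (cong (ℓ x *_) (ℓ-ones i x))

  onesᴰ : ∀ i {a : Fun p} → Definable p a → Definable p (λ v → ones i (a v))
  onesᴰ zero    da = 1ᴰ
  onesᴰ (suc i) da = pow2ᴰ da (onesᴰ i da) ∸ᴰ 1ᴰ

  bound : ℕ → ℕ
  bound x = 2 ^ (ℓ 3 * ℓ (ones k x + x))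

  boundᴰ : ∀ {a : Fun p} → Definable p a → Definable p (λ v → bound (a v))
  boundᴰ da = pow2ᴰ (1ᴰ +ᴰ 1ᴰ +ᴰ 1ᴰ) (onesᴰ k da +ᴰ da)

  nG≤ℓ-bound : ∀ x → nG (ℓ x) ≤ ℓ (bound x)
  nG≤ℓ-bound x =
    ≤-trans (⊔-lub (*-monoʳ-≤ 2 ℓx≤A) (≤-trans ℓx^k≤A (m≤m+n A (A + 0)))) (n≤ℓ[2^n] (2 * A))
    where
    A = ℓ (ones k x + x)
    ℓx≤A : ℓ x ≤ A
    ℓx≤A = ℓ-mono (m≤n+m x (ones k x))
    ℓx^k≤A : ℓ x ^ k ≤ A
    ℓx^k≤A = subst (_≤ A) (ℓ-ones k x) (ℓ-mono (m≤m+n (ones k x) x))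

  value : ℕ → ℕ → ℕ → ℕ
  value e a x = χ (valAt (ℓ x) x e a)

  value-input : ∀ a x → value 0 a x ≡ L0in a x + L0neg a x
  value-input a x with a <ᵇ ℓ x | a <ᵇ 2 * ℓ x
  ... | true  | _     = sym (+-identityʳ _)
  ... | false | true  = refl
  ... | false | false = refl

  value-nonInput : ∀ o x → 2 * ℓ x ≤ o → value 0 o x ≡ 0
  value-nonInput o x 2n≤o
    rewrite ≥⇒<ᵇ≡false (≤-trans (m≤m+n (ℓ x) (ℓ x + 0)) 2n≤o) | ≥⇒<ᵇ≡false 2n≤o = refl

  predecessors : ℕ → ℕ → List ℕ
  predecessors a x = filterᵇ (λ b → wire (ℓ x) b a) (upTo (nG (ℓ x)))

  fanIn : (ℕ → ℕ) → ℕ → ℕ → ℕ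
  fanIn c a x = ∑[ j < ℓ (bound x) ] χ (wire (ℓ x) j a) ⊓ c j

  fanIn-cong : ∀ {c c′ : ℕ → ℕ} a x → (∀ j → c j ≡ c′ j) → fanIn c a x ≡ fanIn c′ a x
  fanIn-cong a x c≡c′ = ∑-cong (ℓ (bound x)) (λ j _ → cong (χ (wire (ℓ x) j a) ⊓_) (c≡c′ j))

  sum-predecessors : ∀ (W : ℕ → Bool) a x →
                     sum (map (χ ∘ W) (predecessors a x)) ≡ fanIn (χ ∘ W) a x
  sum-predecessors W a x = begin
    sum (map (χ ∘ W) (filterᵇ isWire (upTo N)))    ≡⟨ sum-map-filter isWire W (upTo N) ⟩
    sum (map (λ j → χ (isWire j ∧ W j)) (upTo N))  ≡⟨ sum-map-upTo _ N ⟩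
    ∑[ j < N ] χ (isWire j ∧ W j)                   ≡⟨ ∑-extend (nG≤ℓ-bound x) beyondGates ⟨
    ∑[ j < ℓ (bound x) ] χ (isWire j ∧ W j)         ≡⟨ ∑-cong (ℓ (bound x)) (λ j _ → χ-∧ _ _) ⟩
    fanIn (χ ∘ W) a x                               ∎
    where
    open ≡-Reasoning
    N = nG (ℓ x)
    isWire = λ j → wire (ℓ x) j a
    beyondGates : ∀ j → N ≤ j → χ (isWire j ∧ W j) ≡ 0
    beyondGates j N≤j with isWire j in wired
    ... | false = refl
    ... | true  = ⊥-elim (<⇒≱ (proj₁ (wireOK (ℓ x) j a wired)) N≤j)

  fanInᴰ : ∀ {c : ℕ → ℕ → ℕ} → Definable 2 (λ v → c (v (# 0)) (v (# 1))) →
           Definable 2 (λ v → fanIn (λ j → c j (v (# 1))) (v (# 0)) (v (# 1)))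
  fanInᴰ {c} dc = lengthSumᴰ (wiredᴰ ⊓ᴰ app₂ c dc (varᴰ (# 0)) (varᴰ (# 2)))
                             (λ v → ≤-trans (m⊓n≤m _ _) (χ≤1 _)) (boundᴰ (varᴰ (# 1)))
    where
    wiredᴰ = app₃ circC (definable circCF) (varᴰ (# 2)) (varᴰ (# 0)) (varᴰ (# 1))

  combine-∨ : ∀ e bs → e % 3 ≡ 1 → combine e bs ≡ or bs
  combine-∨ e bs e%3≡1 rewrite e%3≡1 = refl

  combine-∧ : ∀ e bs → e % 3 ≡ 2 → combine e bs ≡ and bs
  combine-∧ e bs e%3≡2 rewrite e%3≡2 = refl

  combine-maj : ∀ e bs → e % 3 ≡ 0 → combine e bs ≡ (length bs <ᵇ 2 * length (filterᵇ id bs))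
  combine-maj e bs e%3≡0 rewrite e%3≡0 = refl

  module _ (e a x : ℕ) where
    private
      V  = valAt (ℓ x) x e
      ps = predecessors a x

    count-values : sum (map χ (map V ps)) ≡ fanIn (λ j → value e j x) a x
    count-values = trans (cong sum (sym (map-∘ ps))) (sum-predecessors V a x)

    value-∨ : suc e % 3 ≡ 1 → value (suc e) a x ≡ sg (fanIn (λ j → value e j x) a x)
    value-∨ kind = begin
      χ (combine (suc e) (map V ps))   ≡⟨ cong χ (combine-∨ (suc e) (map V ps) kind) ⟩
      χ (or (map V ps))                ≡⟨ χ-or (map V ps) ⟩
      sg (sum (map χ (map V ps)))      ≡⟨ cong sg count-values ⟩
      sg (fanIn (λ j → value e j x) a x) ∎
      where open ≡-Reasoning

    value-∧ : suc e % 3 ≡ 2 → value (suc e) a x ≡ 1 ∸ sg (fanIn (λ j → 1 ∸ value e j x) a x)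
    value-∧ kind = begin
      χ (combine (suc e) (map V ps))          ≡⟨ cong χ (combine-∧ (suc e) (map V ps) kind) ⟩
      χ (and (map V ps))                      ≡⟨ χ-and (map V ps) ⟩
      1 ∸ sg (sum (map (χ ∘ not) (map V ps))) ≡⟨ cong ((1 ∸_) ∘ sg ∘ sum) (map-∘ ps) ⟨
      1 ∸ sg (sum (map (χ ∘ not ∘ V) ps))     ≡⟨ cong ((1 ∸_) ∘ sg) (sum-predecessors _ a x) ⟩
      1 ∸ sg (fanIn (χ ∘ not ∘ V) a x)        ≡⟨ cong ((1 ∸_) ∘ sg) (fanIn-cong a x (χ-not ∘ V)) ⟩
      1 ∸ sg (fanIn (λ j → 1 ∸ value e j x) a x) ∎
      where open ≡-Reasoning

    value-maj : suc e % 3 ≡ 0 →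
      let T = fanIn (λ j → value e j x) a x in value (suc e) a x ≡ sg (T + T ∸ fanIn (λ _ → 1) a x)
    value-maj kind = begin
      χ (combine (suc e) bs)                        ≡⟨ cong χ (combine-maj (suc e) bs kind) ⟩
      χ (length bs <ᵇ 2 * length (filterᵇ id bs))   ≡⟨ χ-<ᵇ (length bs) _ ⟩
      sg (2 * length (filterᵇ id bs) ∸ length bs)   ≡⟨ cong₂ (λ t u → sg (t + u ∸ length bs))
                                                             trues (trans (+-identityʳ _) trues) ⟩
      sg (T + T ∸ length bs)                        ≡⟨ cong (λ t → sg (T + T ∸ t)) inputs ⟩
      sg (T + T ∸ fanIn (λ _ → 1) a x)              ∎
      where
      open ≡-Reasoning
      bs = map V ps
      T  = fanIn (λ j → value e j x) a x
      trues : length (filterᵇ id bs) ≡ T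
      trues = trans (length-filter-true bs) count-values
      inputs : length bs ≡ fanIn (λ _ → 1) a x
      inputs = begin
        length bs                    ≡⟨ length-map V ps ⟩
        length ps                    ≡⟨ length≡sum-map-1 ps ⟩
        sum (map (λ _ → 1) ps)       ≡⟨ sum-predecessors (λ _ → true) a x ⟩
        fanIn (λ _ → 1) a x          ∎

  valueᴰ : ∀ e → Definable 2 (λ v → value e (v (# 0)) (v (# 1)))
  valueᴰ zero    = definable-cong (definable L0inF +ᴰ definable L0negF)
                                  (λ v → sym (value-input (v (# 0)) (v (# 1))))
  valueᴰ (suc e) = byKind (suc e % 3) refl
    where
    countᴰ = fanInᴰ {c = value e} (valueᴰ e)
    byKind : ∀ r → suc e % 3 ≡ r → Definable 2 (λ v → value (suc e) (v (# 0)) (v (# 1)))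
    byKind 0 kind = definable-cong (sgᴰ (countᴰ +ᴰ countᴰ ∸ᴰ fanInᴰ {c = λ _ _ → 1} 1ᴰ))
                                   (λ v → sym (value-maj e (v (# 0)) (v (# 1)) kind))
    byKind 1 kind = definable-cong (sgᴰ countᴰ) (λ v → sym (value-∨ e (v (# 0)) (v (# 1)) kind))
    byKind 2 kind = definable-cong (1ᴰ ∸ᴰ sgᴰ (fanInᴰ {c = λ j x → 1 ∸ value e j x}
                                                      (1ᴰ ∸ᴰ valueᴰ e)))
                                   (λ v → sym (value-∧ e (v (# 0)) (v (# 1)) kind))
    byKind (suc (suc (suc _))) kind =
      ⊥-elim (≤⇒≯ (s≤s (s≤s (s≤s z≤n))) (subst (_< 3) kind (m%n<n (suc e) 3)))

  -- Lev is only available for e ≥ 1; at level 0 the value itself vanishes off the input gates.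
  levelTerm : ℕ → ℕ → ℕ → ℕ
  levelTerm zero    o x = value 0 o x
  levelTerm (suc e) o x = Lev (suc e) o x ⊓ value (suc e) o x

  levelTerm-off : ∀ e o x → e ≢ lev (ℓ x) o → levelTerm e o x ≡ 0
  levelTerm-off zero o x 0≢lev =
    value-nonInput o x (≮⇒≥ (λ o<2n → 0≢lev (sym (inputLevel (ℓ x) o o<2n))))
  levelTerm-off (suc e) o x e≢lev
    rewrite ≢⇒≡ᵇ≡false (e≢lev ∘ sym) | ∧-zeroʳ (o <ᵇ nG (ℓ x)) = refl

  levelTerm-on : ∀ e o x → o < nG (ℓ x) → lev (ℓ x) o ≡ e → levelTerm e o x ≡ value e o x
  levelTerm-on zero    o x o<nG lev≡0 = refl
  levelTerm-on (suc e) o x o<nG lev≡e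
    rewrite <⇒<ᵇ≡true o<nG | ≡⇒≡ᵇ≡true lev≡e = m≥n⇒m⊓n≡n (χ≤1 _)

  levelSum : ℕ → ℕ → ℕ
  levelSum o x = ∑[ e < suc d ] levelTerm e o x

  levelSum≡gateVal : ∀ o x → o < ℓ x ^ k → levelSum o x ≡ χ (gateVal (ℓ x) x o)
  levelSum≡gateVal o x o<n^k =
    trans (∑-single (suc d) (lev n o) (s≤s lev≤d) (λ e → levelTerm-off e o x))
          (levelTerm-on (lev n o) o x (<-≤-trans o<n^k (m≤n⊔m (2 * n) (n ^ k))) refl)
    where
    n = ℓ x
    lev≤d : lev n o ≤ d
    lev≤d with o <? 2 * n
    ... | yes o<2n = subst (_≤ d) (sym (inputLevel n o o<2n)) z≤n
    ... | no  o≮2n = proj₂ (innerLevel n o (≮⇒≥ o≮2n) o<n^k)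

  levelSumᴰ : Definable 2 (λ v → levelSum (v (# 0)) (v (# 1)))
  levelSumᴰ = ∑ᴰ (suc d) {f = λ e v → levelTerm e (v (# 0)) (v (# 1))} termᴰ
    where
    termᴰ : ∀ e → e < suc d → Definable 2 (λ v → levelTerm e (v (# 0)) (v (# 1)))
    termᴰ zero    _         = valueᴰ 0
    termᴰ (suc e) (s≤s e<d) = definable (LevF (suc e) (s≤s z≤n) e<d) ⊓ᴰ valueᴰ (suc e)

  -- ℓ (ones k x) = n^k locates the output gate n^k − m + i; the sg factor cuts off at i = m.
  outputBit : ℕ → ℕ → ℕ
  outputBit i x = sg (m (ℓ x) ∸ i) ⊓ levelSum (ℓ (ones k x) ∸ m (ℓ x) + i) x

  outputBitᴰ : Definable 2 (λ v → outputBit (v (# 0)) (v (# 1)))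
  outputBitᴰ = sgᴰ (mᴰ ∸ᴰ varᴰ (# 0)) ⊓ᴰ app₂ levelSum levelSumᴰ gateᴰ (varᴰ (# 1))
    where
    mᴰ    = app₁ m (definable mF) (ℓᴰ (varᴰ (# 1)))
    gateᴰ = ℓᴰ (onesᴰ k (varᴰ (# 1))) ∸ᴰ mᴰ +ᴰ varᴰ (# 0)

  outputBit≡gateVal : ∀ i x → let n = ℓ x in
    i < m n → outputBit i x ≡ χ (gateVal n x (n ^ k ∸ m n + i))
  outputBit≡gateVal i x i<M = begin
    sg (M ∸ i) ⊓ levelSum (ℓ (ones k x) ∸ M + i) x
      ≡⟨ cong₂ (λ s t → s ⊓ levelSum (t ∸ M + i) x) (sg-pos (m<n⇒0<n∸m i<M)) (ℓ-ones k x) ⟩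
    1 ⊓ levelSum (n ^ k ∸ M + i) x
      ≡⟨ cong (1 ⊓_) (levelSum≡gateVal _ x o<n^k) ⟩
    1 ⊓ χ (gateVal n x (n ^ k ∸ M + i))
      ≡⟨ m≥n⇒m⊓n≡n (χ≤1 _) ⟩
    χ (gateVal n x (n ^ k ∸ M + i))
      ∎
    where
    open ≡-Reasoning
    n = ℓ x
    M = m n
    o<n^k : n ^ k ∸ M + i < n ^ k
    o<n^k = subst (n ^ k ∸ M + i <_) (m∸n+n≡m (outputsOK n)) (+-monoʳ-< (n ^ k ∸ M) i<M)

  output≡binary : ∀ x → output x ≡ ∑[ i < ℓ (bound x) ] 2 ^ i * outputBit i x
  output≡binary x = begin
    output x                                            ≡⟨ sum-map-upTo _ M ⟩
    ∑[ i < M ] 2 ^ i * χ (gateVal n x (n ^ k ∸ M + i))  ≡⟨ ∑-cong M (λ i i<M →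
                                                             cong (2 ^ i *_) (outputBit≡gateVal i x i<M)) ⟨
    ∑[ i < M ] 2 ^ i * outputBit i x                    ≡⟨ ∑-extend M≤L nonOutputs ⟨
    ∑[ i < ℓ (bound x) ] 2 ^ i * outputBit i x          ∎
    where
    open ≡-Reasoning
    n = ℓ x
    M = m n
    M≤L : M ≤ ℓ (bound x)
    M≤L = ≤-trans (outputsOK n) (≤-trans (m≤n⊔m (2 * n) (n ^ k)) (nG≤ℓ-bound x))
    nonOutputs : ∀ i → M ≤ i → 2 ^ i * outputBit i x ≡ 0
    nonOutputs i M≤i = begin
      2 ^ i * (sg (M ∸ i) ⊓ gate)  ≡⟨ cong (λ t → 2 ^ i * (sg t ⊓ gate)) (m≤n⇒m∸n≡0 M≤i) ⟩
      2 ^ i * 0                    ≡⟨ *-zeroʳ (2 ^ i) ⟩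
      0                            ∎
      where gate = levelSum (ℓ (ones k x) ∸ M + i) x

  outputᴰ : Definable 1 (λ v → output (v (# 0)))
  outputᴰ = definable-cong (binaryᴰ outputBitᴰ (λ _ → ≤-trans (m⊓n≤m _ _) (sg≤1 _)) (boundᴰ (varᴰ (# 0))))
                           λ v → sym (output≡binary (v (# 0)))

proposition9 : (F : NFFamily) (f : ℕ → ℕ) → Eval.Computes F f → Algebra._∈TCDL F f
proposition9 F f computes = witness , inTCDL , λ x → trans (agrees (λ _ → x)) (sym (computes x))
  where open Definability.Definable (Simulation.outputᴰ F)
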